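{- There is a family of unsatisfiable CNF formulas $\{F_n\}_{n=0}^\infty$, with $F_n$ having $\Theta(n)$ variables, such that $F_n$ has Monomial Calculus refutations of degree $2$, but every Nullstellensatz refutation of $F_n$ has degree at least $\lceil\log n\rceil$.
   Context: A CNF formula is refuted via its polynomial encoding over a field $\mathbb F$: a clause $\bigvee_{x\in P}x\vee\bigvee_{y\in N}\bar y$ becomes $\prod_{x\in P}(1-x)\prod_{y\in N}y$, and Boolean axioms $x_i^2-x_i$ are available. Nullstellensatz (NS): a refutation of $p_1,\dots,p_m\in\mathbb F[x_1,\dots,x_n]$ consists of polynomials $g_1,\dots,g_m,h_1,\dots,h_n$ with $\sum_j p_jg_j+\sum_i h_i(x_i^2-x_i)=1$; its degree is the maximum degree of the polynomials $p_jg_j$, $h_i(x_i^2-x_i)$ (equivalently, of a dynamic derivation using linear combinations and multiplication by variables applied only to products of a monomial and an axiom). Monomial Calculus (MC): a refutation of a set $\mathcal P$ is a sequence of polynomials ending in $1$, each in $\mathcal P$, a Boolean axiom, or obtained from earlier ones by linear combination $\alpha p+\beta q$ ($\alpha,\beta\in\mathbb F$) or by multiplication $p\mapsto x_ip$ where $p$ is a monomial or the product of a monomial and an axiom. Degree of an MC refutation: maximum degree of its polynomials. -}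

module Defs where

open import Level using (Level; _⊔_)
open import Algebra.Bundles using (CommutativeRing)
open import Data.Nat as ℕ using (ℕ; zero; _<_; _≤_)
open import Data.Nat.Properties using () renaming (_≟_ to _≟ℕ_)
open import Data.Fin using (Fin; zero; suc)
open import Data.Bool using (Bool; true; false)
open import Data.Vec as V using (Vec; []; _∷_)
open import Data.Vec.Properties using (≡-dec)
open import Data.List as L using (List; []; _∷_; _++_; length; lookup)
open import Data.List.Membership.Propositional using (_∈_)
open import Data.List.Relation.Unary.All using (All)
open import Data.List.Relation.Unary.Any using (Any)
open import Data.Product using (Σ; ∃; _×_; _,_)
open import Data.Sum using (_⊎_)
open import Relation.Nullary using (¬_; yes; no)
open import Relation.Binary.PropositionalEquality using (_≡_)

record Field (c ℓ : Level) : Set (Level.suc (c ⊔ ℓ)) where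
  field
    commutativeRing : CommutativeRing c ℓ
  open CommutativeRing commutativeRing public
  field
    0≉1     : ¬ (0# ≈ 1#)
    inverse : ∀ x → ¬ (x ≈ 0#) → Σ Carrier λ y → (x * y) ≈ 1#

Literal : ℕ → Set
Literal v = Fin v × Bool          -- (x , true) = x ; (x , false) = ¬x

Clause : ℕ → Set
Clause v = List (Literal v)

CNF : ℕ → Set
CNF v = List (Clause v)

Assignment : ℕ → Set
Assignment v = Fin v → Bool

litTrue : ∀ {v} → Assignment v → Literal v → Set
litTrue a (x , b) = a x ≡ b

Satisfies : ∀ {v} → Assignment v → CNF v → Set
Satisfies a F = All (λ C → Any (litTrue a) C) F

Unsatisfiable : ∀ {v} → CNF v → Set
Unsatisfiable F = ∀ a → ¬ Satisfies a F

Mon : ℕ → Set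
Mon n = Vec ℕ n

monDeg : ∀ {n} → Mon n → ℕ
monDeg = V.sum

module Poly {c ℓ} (𝔽 : Field c ℓ) where
  open Field 𝔽 using (Carrier; _≈_; _+_; _*_; -_; 0#; 1#)

  -- a polynomial is a finite formal sum of terms (coefficient , monomial)
  Pol : ℕ → Set c
  Pol n = List (Carrier × Mon n)

  coeff : ∀ {n} → Pol n → Mon n → Carrier
  coeff [] m = 0#
  coeff ((a , m′) ∷ p) m with ≡-dec _≟ℕ_ m′ m
  ... | yes _ = a + coeff p m
  ... | no  _ = coeff p m

  _≐_ : ∀ {n} → Pol n → Pol n → Set ℓ
  p ≐ q = ∀ m → coeff p m ≈ coeff q m

  DegLe : ∀ {n} → ℕ → Pol n → Set ℓ
  DegLe d p = ∀ m → d < monDeg m → coeff p m ≈ 0#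

  term : ∀ {n} → Carrier → Mon n → Pol n
  term a m = (a , m) ∷ []

  const : ∀ {n} → Carrier → Pol n
  const a = term a (V.replicate _ 0)

  one : ∀ {n} → Pol n
  one = const 1#

  zeroP : ∀ {n} → Pol n
  zeroP = []

  _⊕_ : ∀ {n} → Pol n → Pol n → Pol n
  p ⊕ q = p ++ q

  scale : ∀ {n} → Carrier → Pol n → Pol n
  scale a p = L.map (λ { (b , m) → (a * b , m) }) p

  _⊗_ : ∀ {n} → Pol n → Pol n → Pol n
  p ⊗ q = L.concatMap (λ { (a , m) → L.map (λ { (b , m′) → (a * b , V.zipWith ℕ._+_ m m′) }) q }) p

  unitMon : ∀ {n} → Fin n → Mon n
  unitMon {ℕ.suc n} zero    = 1 ∷ V.replicate n 0
  unitMon {ℕ.suc n} (suc i) = 0 ∷ unitMon i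

  var : ∀ {n} → Fin n → Pol n
  var i = term 1# (unitMon i)

  boolAx : ∀ {n} → Fin n → Pol n
  boolAx i = (var i ⊗ var i) ⊕ scale (- 1#) (var i)

  ΣF : ∀ {n} k → (Fin k → Pol n) → Pol n
  ΣF ℕ.zero    f = zeroP
  ΣF (ℕ.suc k) f = f zero ⊕ ΣF k (λ j → f (suc j))

  -- polynomial encoding of CNFs: a clause ⋁_{x∈P} x ∨ ⋁_{y∈N} ¬y becomes
  -- ∏_{x∈P} (1 - x) ∏_{y∈N} y

  encLit : ∀ {n} → Literal n → Pol n
  encLit (x , true)  = one ⊕ scale (- 1#) (var x)
  encLit (x , false) = var x

  encClause : ∀ {n} → Clause n → Pol n
  encClause C = L.foldr (λ l p → encLit l ⊗ p) one C

  encCNF : ∀ {n} → CNF n → List (Pol n)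
  encCNF F = L.map encClause F

  record NSRefutation {n} (P : List (Pol n)) : Set (c ⊔ ℓ) where
    field
      g  : Fin (length P) → Pol n
      h  : Fin n → Pol n
      eq : (ΣF (length P) (λ j → lookup P j ⊗ g j) ⊕ ΣF n (λ i → h i ⊗ boolAx i)) ≐ one

  NSDegLe : ∀ {n} {P : List (Pol n)} → ℕ → NSRefutation P → Set ℓ
  NSDegLe {n} {P} d r =
    (∀ j → DegLe d (lookup P j ⊗ NSRefutation.g r j)) ×
    (∀ i → DegLe d (NSRefutation.h r i ⊗ boolAx i))

  IsAxiom : ∀ {n} → List (Pol n) → Pol n → Set c
  IsAxiom {n} P a = a ∈ P ⊎ Σ (Fin n) λ i → a ≡ boolAx i

  IsMonomial : ∀ {n} → Pol n → Set (c ⊔ ℓ)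
  IsMonomial {n} p = Σ Carrier λ a → Σ (Mon n) λ m → p ≐ term a m

  IsMonAxiom : ∀ {n} → List (Pol n) → Pol n → Set (c ⊔ ℓ)
  IsMonAxiom {n} P p = Σ Carrier λ a → Σ (Mon n) λ m → Σ (Pol n) λ q →
                         IsAxiom P q × (p ≐ (term a m ⊗ q))

  data MCDeriv {n} (P : List (Pol n)) (d : ℕ) : Pol n → Set (c ⊔ ℓ) where
    axP  : ∀ {p} → p ∈ P → DegLe d p → MCDeriv P d p
    axB  : ∀ i → DegLe d (boolAx i) → MCDeriv P d (boolAx i)
    lin  : ∀ {p q} (α β : Carrier) → MCDeriv P d p → MCDeriv P d q →
           DegLe d (scale α p ⊕ scale β q) → MCDeriv P d (scale α p ⊕ scale β q)
    mul  : ∀ {p} (i : Fin n) → MCDeriv P d p → (IsMonomial p ⊎ IsMonAxiom P p) →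
           DegLe d (var i ⊗ p) → MCDeriv P d (var i ⊗ p)

  MCRefutes : ∀ {n} → ℕ → List (Pol n) → Set (c ⊔ ℓ)
  MCRefutes d P = Σ _ λ q → MCDeriv P d q × (q ≐ one)

IsΘn : (ℕ → ℕ) → Set
IsΘn f = Σ ℕ λ c₁ → Σ ℕ λ c₂ → Σ ℕ λ n₀ →
           ∀ n → n₀ ≤ n → (n ≤ c₁ ℕ.* f n) × (f n ≤ c₂ ℕ.* n)

module Submission where

-- The formulas express induction along a path: x₀, x_j → x_{j+1} for j < N, ¬ x_N.
--
-- Monomial Calculus derives x_N, x_{N-1}, …, x₀ in degree 2: x_j x_{j+1} is a
-- legal multiple of the derived monomial x_{j+1}, adding the axiom
-- x_j (1 - x_{j+1}) leaves x_j, and finally (1 - x₀) + x₀ = 1.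
--
-- Nullstellensatz is handled by duality.  Read the support of a monomial,
-- without x₀, as a configuration of the reversible pebble game on the path
-- x₁ … x_N, and let the linear functional take the value 1 on monomials whose
-- configuration is reachable with d pebbles and 0 elsewhere.  It is 1 on 1,
-- sees only supports and so kills the Boolean axioms, and kills every axiom
-- multiple of degree ≤ d: for x_j (1 - x_{j+1}) g, either a monomial m of g has
-- degree ≤ d - 2 and x_j m, x_j x_{j+1} m are one legal move apart, or the
-- degree bound forces its coefficient to vanish; x_N is never pebbled since
-- d pebbles reach only the first 2 ^ d - 1 positions.  Applying it to a
-- refutation gives 1 = 0, so every refutation has degree at least log₂ N.

open import Defs
open import Level using (Level)
open import Data.Nat using (ℕ; _≤_)
open import Data.Nat.Logarithm using (⌈log₂_⌉)
open import Data.Product using (Σ; _×_; proj₁; proj₂)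

module Pebbling where
  open import Data.Bool using (Bool; true; false; not)
  open import Data.Empty using (⊥-elim)
  open import Data.List using (List; []; _∷_; take; drop; length)
  open import Data.Nat using (ℕ; _>_; zero; suc; pred; _+_; _∸_; _^_; _≤_; _<_; z≤n; s≤s; _≟_; _≤?_; _<?_)
  open import Data.Nat.Properties
  open import Data.Product using (_×_; _,_)
  open import Data.Sum using (_⊎_; inj₁; inj₂)
  open import Function.Base using (id; _∘_)
  open import Function.Bundles using (_⇔_; mk⇔)
  open import Relation.Nullary using (¬_; Dec; yes; no; contradiction)
  open import Relation.Nullary.Decidable using (_×-dec_; _⊎-dec_; ¬?)
  open import Relation.Binary.PropositionalEquality

  Config : Set
  Config = List Bool

  _at_ : Config → ℕ → Bool
  []      at _     = false
  (b ∷ C) at zero  = b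
  (b ∷ C) at suc j = C at j

  toggle : ℕ → Config → Config
  toggle _       []      = []
  toggle zero    (b ∷ C) = not b ∷ C
  toggle (suc j) (b ∷ C) = b ∷ toggle j C

  place : ℕ → Config → Config
  place _       []      = []
  place zero    (b ∷ C) = true ∷ C
  place (suc j) (b ∷ C) = b ∷ place j C

  pebbles : Config → ℕ
  pebbles []          = 0
  pebbles (false ∷ C) = pebbles C
  pebbles (true  ∷ C) = suc (pebbles C)

  -- Reversible pebbling of a path: position 0 may always be toggled,
  -- position c + 1 whenever position c is pebbled.
  data Legal (C : Config) : ℕ → Set where
    legal-first : Legal C 0
    legal-next  : ∀ {c} → C at c ≡ true → Legal C (suc c)

  -- The configurations reachable from the empty one with at most k pebbles,
  -- described recursively: with T = 2 ^ (k - 1), the suffix beyond T is played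
  -- as a game with k - 1 pebbles, and it can be occupied only while the
  -- prefix is not (k - 1)-good, i.e. still holds the pebble used to enter it.
  Good : ℕ → Config → Set
  Good zero    C = pebbles C ≡ 0
  Good (suc k) C = pebbles C ≤ suc k × Good k (drop (2 ^ k) C) ×
                   (pebbles (drop (2 ^ k) C) ≡ 0 ⊎ ¬ Good k (take (2 ^ k) C))

  good? : ∀ k C → Dec (Good k C)
  good? zero    C = pebbles C ≟ 0
  good? (suc k) C = pebbles C ≤? suc k ×-dec good? k (drop (2 ^ k) C) ×-dec
                    (pebbles (drop (2 ^ k) C) ≟ 0 ⊎-dec ¬? (good? k (take (2 ^ k) C)))

  toggle-involutive : ∀ p C → toggle p (toggle p C) ≡ C
  toggle-involutive _       []          = refl
  toggle-involutive zero    (true ∷ C)  = refl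
  toggle-involutive zero    (false ∷ C) = refl
  toggle-involutive (suc p) (b ∷ C)     = cong (b ∷_) (toggle-involutive p C)

  at-toggle-suc : ∀ c C → toggle (suc c) C at c ≡ C at c
  at-toggle-suc _       []      = refl
  at-toggle-suc zero    (b ∷ C) = refl
  at-toggle-suc (suc c) (b ∷ C) = at-toggle-suc c C

  at-take : ∀ {T c} C → c < T → take T C at c ≡ C at c
  at-take             []      (s≤s _)   = refl
  at-take {c = zero}  (b ∷ C) (s≤s _)   = refl
  at-take {c = suc c} (b ∷ C) (s≤s c<T) = at-take C c<T

  at-drop : ∀ T q C → drop T C at q ≡ C at (T + q)
  at-drop zero    q C       = refl
  at-drop (suc T) q []      = refl
  at-drop (suc T) q (b ∷ C) = at-drop T q C

  take-toggle-< : ∀ {T p} C → p < T → take T (toggle p C) ≡ toggle p (take T C)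
  take-toggle-<             []      (s≤s _)   = refl
  take-toggle-< {p = zero}  (b ∷ C) (s≤s _)   = refl
  take-toggle-< {p = suc p} (b ∷ C) (s≤s p<T) = cong (b ∷_) (take-toggle-< C p<T)

  drop-toggle-< : ∀ {T p} C → p < T → drop T (toggle p C) ≡ drop T C
  drop-toggle-<             []      (s≤s _)   = refl
  drop-toggle-< {p = zero}  (b ∷ C) (s≤s _)   = refl
  drop-toggle-< {p = suc p} (b ∷ C) (s≤s p<T) = drop-toggle-< C p<T

  take-toggle-+ : ∀ T q C → take T (toggle (T + q) C) ≡ take T C
  take-toggle-+ zero    q C       = refl
  take-toggle-+ (suc T) q []      = refl
  take-toggle-+ (suc T) q (b ∷ C) = cong (b ∷_) (take-toggle-+ T q C)

  drop-toggle-+ : ∀ T q C → drop T (toggle (T + q) C) ≡ toggle q (drop T C)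
  drop-toggle-+ zero    q C       = refl
  drop-toggle-+ (suc T) q []      = refl
  drop-toggle-+ (suc T) q (b ∷ C) = drop-toggle-+ T q C

  pebbles-take-drop : ∀ T C → pebbles C ≡ pebbles (take T C) + pebbles (drop T C)
  pebbles-take-drop zero    C           = refl
  pebbles-take-drop (suc T) []          = refl
  pebbles-take-drop (suc T) (false ∷ C) = pebbles-take-drop T C
  pebbles-take-drop (suc T) (true ∷ C)  = cong suc (pebbles-take-drop T C)

  at-pebbles≡0 : ∀ c C → pebbles C ≡ 0 → C at c ≡ false
  at-pebbles≡0 _       []          _  = refl
  at-pebbles≡0 zero    (false ∷ C) _  = refl
  at-pebbles≡0 (suc c) (false ∷ C) eq = at-pebbles≡0 c C eq

  pebbles-drop≤ : ∀ T C → pebbles (drop T C) ≤ pebbles C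
  pebbles-drop≤ T C = subst (pebbles (drop T C) ≤_) (sym (pebbles-take-drop T C)) (m≤n+m _ _)

  at-place : ∀ j C → j < length C → place j C at j ≡ true
  at-place zero    (b ∷ C) _         = refl
  at-place (suc j) (b ∷ C) (s≤s j<n) = at-place j C j<n

  place-pebbled : ∀ j C → C at j ≡ true → place j C ≡ C
  place-pebbled _       []          _  = refl
  place-pebbled zero    (true ∷ C)  _  = refl
  place-pebbled (suc j) (b ∷ C)     eq = cong (b ∷_) (place-pebbled j C eq)

  place-empty : ∀ j C → C at j ≡ false → place j C ≡ toggle j C
  place-empty _       []          _  = refl
  place-empty zero    (false ∷ C) _  = refl
  place-empty (suc j) (b ∷ C)     eq = cong (b ∷_) (place-empty j C eq)

  Legal-toggle : ∀ {C p} → Legal C p → Legal (toggle p C) p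
  Legal-toggle         legal-first     = legal-first
  Legal-toggle {C} (legal-next {c} eq) = legal-next (trans (at-toggle-suc c C) eq)

  Legal-take : ∀ {T C p} → p < T → Legal C p → Legal (take T C) p
  Legal-take _   legal-first     = legal-first
  Legal-take {C = C} p<T (legal-next eq) = legal-next (trans (at-take C (<⇒≤ p<T)) eq)

  Legal-drop : ∀ T {C q} → Legal C (T + q) → Legal (drop T C) q
  Legal-drop T {q = zero}  _ = legal-first
  Legal-drop T {C} {suc q} l = from l refl
    where
    from : ∀ {p} → Legal C p → p ≡ T + suc q → Legal (drop T C) (suc q)
    from legal-first     p≡ = ⊥-elim (0≢1+n (trans p≡ (+-suc T q)))
    from (legal-next eq) p≡ = legal-next (trans (at-drop T q C)
      (subst (λ i → C at i ≡ true) (suc-injective (trans p≡ (+-suc T q))) eq))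

  data Side (T : ℕ) : ℕ → Set where
    before : ∀ {p} → p < T → Side T p
    beyond : ∀ q → Side T (T + q)

  side : ∀ T p → Side T p
  side T p with p <? T
  ... | yes p<T = before p<T
  ... | no  p≮T = subst (Side T) (m+[n∸m]≡n (≮⇒≥ p≮T)) (beyond (p ∸ T))

  m+n≤1+k∧m≢0⇒n≤k : ∀ m {n k} → m + n ≤ suc k → m ≢ 0 → n ≤ k
  m+n≤1+k∧m≢0⇒n≤k zero    _        m≢0 = contradiction refl m≢0
  m+n≤1+k∧m≢0⇒n≤k (suc m) (s≤s le) _   = m+n≤o⇒n≤o m le

  pebbles-take≢0⇒drop≤ : ∀ T C {k} → pebbles C ≤ suc k → pebbles (take T C) ≢ 0 → pebbles (drop T C) ≤ k
  pebbles-take≢0⇒drop≤ T C C≤1+k =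
    m+n≤1+k∧m≢0⇒n≤k (pebbles (take T C)) (subst (_≤ suc _) (pebbles-take-drop T C) C≤1+k)

  pebbles-drop≢0⇒take≤ : ∀ T C {k} → pebbles C ≤ suc k → pebbles (drop T C) ≢ 0 → pebbles (take T C) ≤ k
  pebbles-drop≢0⇒take≤ T C C≤1+k = m+n≤1+k∧m≢0⇒n≤k (pebbles (drop T C))
    (subst (_≤ suc _) (trans (pebbles-take-drop T C) (+-comm (pebbles (take T C)) _)) C≤1+k)

  Good-empty : ∀ k C → pebbles C ≡ 0 → Good k C
  Good-empty zero    C empty = empty
  Good-empty (suc k) C empty =
    subst (_≤ suc k) (sym empty) z≤n , Good-empty k (drop (2 ^ k) C) emptyU , inj₁ emptyU
    where
    emptyU : pebbles (drop (2 ^ k) C) ≡ 0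
    emptyU = n≤0⇒n≡0 (subst (pebbles (drop (2 ^ k) C) ≤_) empty (pebbles-drop≤ (2 ^ k) C))

  Good-sound : ∀ k C j → Good k C → 2 ^ k ≤ suc j → C at j ≡ false
  Good-sound zero    C j empty _ = at-pebbles≡0 j C empty
  Good-sound (suc k) C j (_ , goodU , _) 2T≤1+j with side (2 ^ k) j
  ... | before j<T = contradiction (≤-trans 2T≤1+j j<T) (<⇒≱ (m<m+n T T+0>0))
    where
    T = 2 ^ k
    T+0>0 : T + 0 > 0
    T+0>0 = ≤-trans (m^n>0 2 k) (m≤m+n T 0)
  ... | beyond q = trans (sym (at-drop T q C)) (Good-sound k (drop T C) q goodU T≤1+q)
    where
    open ≤-Reasoning
    T = 2 ^ k
    T≤1+q : T ≤ suc q
    T≤1+q = +-cancelˡ-≤ T T (suc q) (begin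
      T + T       ≡⟨ cong (T +_) (+-identityʳ T) ⟨
      T + (T + 0) ≤⟨ 2T≤1+j ⟩
      suc (T + q) ≡⟨ +-suc T q ⟨
      T + suc q   ∎)

  entering-beyond : ∀ {T C q} → 0 < T → Legal C (T + q) → pebbles (drop T C) ≡ 0 →
                    take T C at pred T ≡ true
  entering-beyond {suc t} {C} {zero} _ (legal-next eq) _ =
    trans (at-take C ≤-refl) (subst (λ i → C at i ≡ true) (+-identityʳ t) eq)
  entering-beyond {T} {C} {suc q} _ legal empty with Legal-drop T legal
  ... | legal-next eq = contradiction (trans (sym eq) (at-pebbles≡0 q (drop T C) empty)) λ ()

  -- Entering the suffix needs a pebble on position 2 ^ k - 1, which no
  -- k-good configuration has.
  beyond-blocks-prefix : ∀ k {C q} → Legal C (2 ^ k + q) → Good (suc k) C → ¬ Good k (take (2 ^ k) C)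
  beyond-blocks-prefix k legal (_ , _ , inj₂ bad) = bad
  beyond-blocks-prefix k {C} legal (_ , _ , inj₁ empty) good
    with () ← trans (sym (entering-beyond (m^n>0 2 k) legal empty))
                    (Good-sound k (take (2 ^ k) C) (pred (2 ^ k)) good
                      (≤-reflexive (sym (suc-pred (2 ^ k) {{m^n≢0 2 k}}))))

  Closed : ℕ → Set
  Closed k = ∀ {C p} → Legal C p → Good k C → pebbles (toggle p C) ≤ k → Good k (toggle p C)

  Good-closed-before : ∀ {k} → Closed k → ∀ {C p} → p < 2 ^ k → Legal C p → Good (suc k) C →
                       pebbles (toggle p C) ≤ suc k → Good (suc k) (toggle p C)
  Good-closed-before {k} closed {C} {p} p<T legal (bound , goodU , guard) bound′
    rewrite drop-toggle-< C p<T | take-toggle-< C p<T = bound′ , goodU , guard′ guard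
    where
    T = 2 ^ k
    L = take T C
    guard′ : pebbles (drop T C) ≡ 0 ⊎ ¬ Good k L → pebbles (drop T C) ≡ 0 ⊎ ¬ Good k (toggle p L)
    guard′ (inj₁ empty) = inj₁ empty
    guard′ (inj₂ bad) with pebbles (drop T C) ≟ 0
    ... | yes empty   = inj₁ empty
    ... | no occupied = inj₂ λ good′ → bad (subst (Good k) (toggle-involutive p L)
            (closed (Legal-toggle (Legal-take p<T legal)) good′ boundL))
      where
      boundL : pebbles (toggle p (toggle p L)) ≤ k
      boundL = subst (λ L′ → pebbles L′ ≤ k) (sym (toggle-involutive p L))
        (pebbles-drop≢0⇒take≤ T C bound occupied)

  Good-closed-beyond : ∀ {k} → Closed k → ∀ {C} q → Legal C (2 ^ k + q) → Good (suc k) C →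
                       pebbles (toggle (2 ^ k + q) C) ≤ suc k → Good (suc k) (toggle (2 ^ k + q) C)
  Good-closed-beyond {k} closed {C} q legal good@(_ , goodU , _) bound′
    rewrite drop-toggle-+ (2 ^ k) q C | take-toggle-+ (2 ^ k) q C = bound′ , goodU′ , inj₂ bad
    where
    T = 2 ^ k
    bad : ¬ Good k (take T C)
    bad = beyond-blocks-prefix k legal good
    boundU′ : pebbles (toggle q (drop T C)) ≤ k
    boundU′ = subst (λ U → pebbles U ≤ k) (drop-toggle-+ T q C)
      (pebbles-take≢0⇒drop≤ T _ bound′ (subst (λ L → pebbles L ≢ 0) (sym (take-toggle-+ T q C))
                                                (bad ∘ Good-empty k (take T C))))
    goodU′ : Good k (toggle q (drop T C))
    goodU′ = closed (Legal-drop T legal) goodU boundU′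

  Good-closed : ∀ k → Closed k
  Good-closed zero    _     _    bound = n≤0⇒n≡0 bound
  Good-closed (suc k) {p = p} legal good bound with side (2 ^ k) p
  ... | before p<T = Good-closed-before (Good-closed k) p<T legal good bound
  ... | beyond q   = Good-closed-beyond (Good-closed k) q legal good bound

  Good-place : ∀ k {C j} → Legal C j → pebbles C ≤ k → pebbles (place j C) ≤ k →
               Good k C ⇔ Good k (place j C)
  Good-place k {C} {j} legal bound bound′ with C at j in eq
  ... | true  rewrite place-pebbled j C eq = mk⇔ id id
  ... | false rewrite place-empty j C eq =
    mk⇔ (λ good → Good-closed k legal good bound′)
        (λ good → subst (Good k) (toggle-involutive j C) (Good-closed k (Legal-toggle legal) good
                    (subst (λ C′ → pebbles C′ ≤ k) (sym (toggle-involutive j C)) bound)))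

module InductionFormula where
  open import Data.Bool using (true; false)
  open import Data.Bool.Properties using (not-¬)
  open import Data.Fin using (Fin; zero; suc; inject₁; fromℕ)
  open import Data.Fin.Induction using (<-weakInduction)
  open import Data.List using ([]; _∷_; _++_; map; allFin)
  open import Data.List.Membership.Propositional using (_∈_)
  open import Data.List.Membership.Propositional.Properties using (∈-map⁺; ∈-++⁺ˡ; ∈-++⁺ʳ; ∈-allFin)
  open import Data.List.Relation.Unary.All as All using (All; []; _∷_)
  open import Data.List.Relation.Unary.All.Properties using (++⁺; map⁺; tabulate⁺)
  open import Data.List.Relation.Unary.Any using (Any; here; there)
  open import Data.Nat using (ℕ; suc)
  open import Data.Product using (_,_)
  open import Relation.Nullary using (contradiction)
  open import Relation.Binary.PropositionalEquality

  private variable n : ℕ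

  unit⁺ unit⁻ : Fin n → Clause n
  unit⁺ i = (i , true) ∷ []
  unit⁻ i = (i , false) ∷ []

  implication : Fin n → Fin n → Clause n
  implication a b = (a , false) ∷ (b , true) ∷ []

  induction-step : ∀ {N} → Fin N → Clause (suc N)
  induction-step j = implication (inject₁ j) (suc j)

  inductionCNF : ∀ N → CNF (suc N)
  inductionCNF N = unit⁺ zero ∷ map induction-step (allFin N) ++ unit⁻ (fromℕ N) ∷ []

  module _ {N : ℕ} where

    unit⁺∈inductionCNF : unit⁺ zero ∈ inductionCNF N
    unit⁺∈inductionCNF = here refl

    step∈inductionCNF : ∀ j → induction-step j ∈ inductionCNF N
    step∈inductionCNF j = there (∈-++⁺ˡ (∈-map⁺ induction-step (∈-allFin j)))

    unit⁻∈inductionCNF : unit⁻ (fromℕ N) ∈ inductionCNF N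
    unit⁻∈inductionCNF = there (∈-++⁺ʳ _ (here refl))

    All-inductionCNF : ∀ {p} {P : Clause (suc N) → Set p} → P (unit⁺ zero) →
                       (∀ j → P (induction-step j)) → P (unit⁻ (fromℕ N)) → All P (inductionCNF N)
    All-inductionCNF start step end = start ∷ ++⁺ (map⁺ (tabulate⁺ step)) (end ∷ [])

  unit-forced : ∀ {a : Assignment n} {i b} → Any (litTrue a) ((i , b) ∷ []) → a i ≡ b
  unit-forced (here ai≡b) = ai≡b

  implication-forced : ∀ {a : Assignment n} {i j} → Any (litTrue a) (implication i j) → a i ≡ true → a j ≡ true
  implication-forced (here ai≡false)         ai≡true = contradiction ai≡false (not-¬ ai≡true)
  implication-forced (there (here aj≡true)) _       = aj≡true

  inductionCNF-unsatisfiable : ∀ N → Unsatisfiable (inductionCNF N)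
  inductionCNF-unsatisfiable N a sat = not-¬ (all-true (fromℕ N)) (unit-forced (holds unit⁻∈inductionCNF))
    where
    holds : ∀ {C} → C ∈ inductionCNF N → Any (litTrue a) C
    holds = All.lookup sat
    all-true : ∀ i → a i ≡ true
    all-true = <-weakInduction (λ i → a i ≡ true) (unit-forced (holds unit⁺∈inductionCNF))
                               (λ j → implication-forced (holds (step∈inductionCNF j)))

module Monomials {c ℓ} (𝔽 : Field c ℓ) where
  open import Data.Nat using (ℕ; zero; suc; _+_)
  open import Data.Nat.Properties
  open import Data.Fin using (Fin; zero; suc)
  open import Data.Vec as V using ([]; _∷_; lookup)
  open import Data.Vec.Properties using (∷-injectiveˡ; ∷-injectiveʳ)
  open import Data.Vec.Relation.Binary.Pointwise.Inductive
    using (Pointwise-≡⇒≡; zipWith-assoc; zipWith-comm; zipWith-identityˡ; zipWith-identityʳ)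
  open import Algebra.Properties.CommutativeSemigroup +-commutativeSemigroup using (interchange)
  open import Relation.Binary.PropositionalEquality
  open Poly 𝔽 using (unitMon)

  private variable n : ℕ

  infixl 7 _·_
  _·_ : Mon n → Mon n → Mon n
  _·_ = V.zipWith _+_

  𝟏 : Mon n
  𝟏 = V.replicate _ 0

  ·-assoc : ∀ (u v w : Mon n) → (u · v) · w ≡ u · (v · w)
  ·-assoc u v w = Pointwise-≡⇒≡ (zipWith-assoc +-assoc u v w)

  ·-comm : ∀ (u v : Mon n) → u · v ≡ v · u
  ·-comm u v = Pointwise-≡⇒≡ (zipWith-comm +-comm u v)

  ·-identityˡ : ∀ (u : Mon n) → 𝟏 · u ≡ u
  ·-identityˡ u = Pointwise-≡⇒≡ (zipWith-identityˡ +-identityˡ u)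

  ·-identityʳ : ∀ (u : Mon n) → u · 𝟏 ≡ u
  ·-identityʳ u = Pointwise-≡⇒≡ (zipWith-identityʳ +-identityʳ u)

  ·-cancelˡ : ∀ (u : Mon n) {v w} → u · v ≡ u · w → v ≡ w
  ·-cancelˡ []      {[]}    {[]}    _  = refl
  ·-cancelˡ (x ∷ u) {y ∷ v} {z ∷ w} eq =
    cong₂ _∷_ (+-cancelˡ-≡ x y z (∷-injectiveˡ eq)) (·-cancelˡ u (∷-injectiveʳ eq))

  monDeg-· : ∀ (u v : Mon n) → monDeg (u · v) ≡ monDeg u + monDeg v
  monDeg-· []      []      = refl
  monDeg-· (x ∷ u) (y ∷ v) = trans (cong (x + y +_) (monDeg-· u v)) (interchange x y (monDeg u) (monDeg v))

  monDeg-𝟏 : monDeg (𝟏 {n}) ≡ 0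
  monDeg-𝟏 {zero}  = refl
  monDeg-𝟏 {suc n} = monDeg-𝟏 {n}

  monDeg-unitMon : ∀ (i : Fin n) → monDeg (unitMon i) ≡ 1
  monDeg-unitMon {suc n} zero    = cong suc (monDeg-𝟏 {n})
  monDeg-unitMon         (suc i) = monDeg-unitMon i

  monDeg-unitMon-· : ∀ (i : Fin n) m → monDeg (unitMon i · m) ≡ suc (monDeg m)
  monDeg-unitMon-· i m = trans (monDeg-· (unitMon i) m) (cong (_+ monDeg m) (monDeg-unitMon i))

  u·[v·w]≡v·[u·w] : ∀ (u v w : Mon n) → u · (v · w) ≡ v · (u · w)
  u·[v·w]≡v·[u·w] u v w = trans (sym (·-assoc u v w)) (trans (cong (_· w) (·-comm u v)) (·-assoc v u w))

  lookup-unitMon : ∀ (i : Fin n) → lookup (unitMon i) i ≡ 1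
  lookup-unitMon zero    = refl
  lookup-unitMon (suc i) = lookup-unitMon i

module Functionals {c ℓ} (𝔽 : Field c ℓ) where
  open import Data.Nat using (ℕ)
  open import Data.Fin using (Fin)
  open import Data.List as L using ([]; _∷_; _++_)
  open import Data.Bool using (true)
  open import Data.Product using (_,_; _,′_; proj₁; proj₂)
  import Relation.Binary.PropositionalEquality as ≡

  open Field 𝔽 hiding (zero)
  open Poly 𝔽
  open Monomials 𝔽
  open InductionFormula
  open import Algebra.Properties.Ring ring using (-1*x≈-x)
  open import Algebra.Properties.CommutativeSemigroup +-commutativeSemigroup using (interchange)
  open import Relation.Binary.Reasoning.Setoid setoid

  private variable n : ℕ

  -- It is computed term by term, so unlike coeff it reduces on concrete
  -- polynomials without deciding equality of monomials.
  Λ : (Mon n → Carrier) → Pol n → Carrier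
  Λ F []            = 0#
  Λ F ((a , m) ∷ p) = a * F m + Λ F p

  Λ-cong : ∀ {F G : Mon n → Carrier} p → (∀ m → F m ≈ G m) → Λ F p ≈ Λ G p
  Λ-cong []            F≈G = refl
  Λ-cong ((a , m) ∷ p) F≈G = +-cong (*-congˡ (F≈G m)) (Λ-cong p F≈G)

  Λ-zero : ∀ {F : Mon n → Carrier} p → (∀ m → F m ≈ 0#) → Λ F p ≈ 0#
  Λ-zero []            F≈0 = refl
  Λ-zero ((a , m) ∷ p) F≈0 = begin
    a * _ + Λ _ p ≈⟨ +-cong (*-congˡ (F≈0 m)) (Λ-zero p F≈0) ⟩
    a * 0# + 0#   ≈⟨ +-identityʳ _ ⟩
    a * 0#        ≈⟨ zeroʳ a ⟩
    0#            ∎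

  Λ-+ : ∀ F G (p : Pol n) → Λ (λ m → F m + G m) p ≈ Λ F p + Λ G p
  Λ-+ F G []            = sym (+-identityʳ 0#)
  Λ-+ F G ((a , m) ∷ p) = begin
    a * (F m + G m) + Λ (λ m → F m + G m) p ≈⟨ +-cong (distribˡ a (F m) (G m)) (Λ-+ F G p) ⟩
    (a * F m + a * G m) + (Λ F p + Λ G p)   ≈⟨ interchange _ _ _ _ ⟩
    (a * F m + Λ F p) + (a * G m + Λ G p)   ∎

  Λ-* : ∀ k F (p : Pol n) → Λ (λ m → k * F m) p ≈ k * Λ F p
  Λ-* k F []            = sym (zeroʳ k)
  Λ-* k F ((a , m) ∷ p) = begin
    a * (k * F m) + Λ (λ m → k * F m) p ≈⟨ +-cong (x∙yz≈y∙xz a k (F m)) (Λ-* k F p) ⟩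
    k * (a * F m) + k * Λ F p           ≈⟨ distribˡ k _ _ ⟨
    k * (a * F m + Λ F p)               ∎
    where open import Algebra.Properties.CommutativeSemigroup *-commutativeSemigroup using (x∙yz≈y∙xz)

  Λ-- : ∀ F G (p : Pol n) → Λ (λ m → F m - G m) p ≈ Λ F p - Λ G p
  Λ-- F G p = begin
    Λ (λ m → F m - G m) p          ≈⟨ Λ-cong p (λ m → +-congˡ (-1*x≈-x (G m))) ⟨
    Λ (λ m → F m + - 1# * G m) p   ≈⟨ Λ-+ F _ p ⟩
    Λ F p + Λ (λ m → - 1# * G m) p ≈⟨ +-congˡ (Λ-* (- 1#) G p) ⟩
    Λ F p + - 1# * Λ G p           ≈⟨ +-congˡ (-1*x≈-x _) ⟩
    Λ F p - Λ G p                  ∎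

  Λ-⊕ : ∀ F (p q : Pol n) → Λ F (p ⊕ q) ≈ Λ F p + Λ F q
  Λ-⊕ F []            q = sym (+-identityˡ _)
  Λ-⊕ F ((a , m) ∷ p) q = trans (+-congˡ (Λ-⊕ F p q)) (sym (+-assoc _ _ _))

  Λ-scale : ∀ F a (p : Pol n) → Λ F (scale a p) ≈ a * Λ F p
  Λ-scale F a []            = sym (zeroʳ a)
  Λ-scale F a ((b , m) ∷ p) = begin
    (a * b) * F m + Λ F (scale a p) ≈⟨ +-cong (*-assoc a b (F m)) (Λ-scale F a p) ⟩
    a * (b * F m) + a * Λ F p       ≈⟨ distribˡ a _ _ ⟨
    a * (b * F m + Λ F p)           ∎

  Λ-lin : ∀ F α β (p q : Pol n) → Λ F (scale α p ⊕ scale β q) ≈ α * Λ F p + β * Λ F q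
  Λ-lin F α β p q = trans (Λ-⊕ F (scale α p) (scale β q)) (+-cong (Λ-scale F α p) (Λ-scale F β q))

  infixl 7 _⋆_
  -- F ⋆ p is the functional g ↦ Λ F (p ⊗ g), see Λ-⊗.
  _⋆_ : (Mon n → Carrier) → Pol n → Mon n → Carrier
  (F ⋆ p) m = Λ (λ u → F (u · m)) p

  Λ-map-term : ∀ F a u (q : Pol n) →
               Λ F (L.map (λ t → a * proj₁ t ,′ u · proj₂ t) q) ≈ a * Λ (λ m → F (u · m)) q
  Λ-map-term F a u []            = sym (zeroʳ a)
  Λ-map-term F a u ((b , m) ∷ q) = begin
    (a * b) * F (u · m) + Λ F (L.map _ q)              ≈⟨ +-cong (*-assoc a b _) (Λ-map-term F a u q) ⟩
    a * (b * F (u · m)) + a * Λ (λ m → F (u · m)) q    ≈⟨ distribˡ a _ _ ⟨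
    a * (b * F (u · m) + Λ (λ m → F (u · m)) q)        ∎

  Λ-⊗ : ∀ F (p q : Pol n) → Λ F (p ⊗ q) ≈ Λ (F ⋆ p) q
  Λ-⊗ F []            q = sym (Λ-zero q (λ _ → refl))
  Λ-⊗ F ((a , u) ∷ p) q = begin
    Λ F (L.map _ q ++ p ⊗ q)                  ≈⟨ Λ-⊕ F (L.map _ q) (p ⊗ q) ⟩
    Λ F (L.map _ q) + Λ F (p ⊗ q)             ≈⟨ +-cong (Λ-map-term F a u q) (Λ-⊗ F p q) ⟩
    a * Λ (λ m → F (u · m)) q + Λ (F ⋆ p) q   ≈⟨ +-congʳ (Λ-* a _ q) ⟨
    Λ (λ m → a * F (u · m)) q + Λ (F ⋆ p) q   ≈⟨ Λ-+ _ _ q ⟨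
    Λ (F ⋆ ((a , u) ∷ p)) q                   ∎

  ⋆-⊗ : ∀ F (p q : Pol n) m → (F ⋆ (p ⊗ q)) m ≈ ((F ⋆ p) ⋆ q) m
  ⋆-⊗ F p q m = trans (Λ-⊗ _ p q)
    (Λ-cong q λ v → Λ-cong p λ u → reflexive (≡.cong F (·-assoc u v m)))

  Λ-⋆-𝟏 : ∀ F (p : Pol n) → Λ F p ≈ (F ⋆ p) 𝟏
  Λ-⋆-𝟏 F p = Λ-cong p λ u → reflexive (≡.cong F (≡.sym (·-identityʳ u)))

  1*x+0≈x : ∀ x → 1# * x + 0# ≈ x
  1*x+0≈x x = trans (+-identityʳ _) (*-identityˡ x)

  a*x+[b*y+0]≈x-y : ∀ {a b} x y → a ≈ 1# → b ≈ - 1# → a * x + (b * y + 0#) ≈ x - y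
  a*x+[b*y+0]≈x-y {a} {b} x y a≈1 b≈-1 = begin
    a * x + (b * y + 0#) ≈⟨ +-cong (*-congʳ a≈1) (+-identityʳ _) ⟩
    1# * x + b * y       ≈⟨ +-cong (*-identityˡ x) (trans (*-congʳ b≈-1) (-1*x≈-x y)) ⟩
    x - y                ∎

  -1*1≈-1 : - 1# * 1# ≈ - 1#
  -1*1≈-1 = *-identityʳ (- 1#)

  Λ-one : ∀ F → Λ {n} F one ≈ F 𝟏
  Λ-one F = 1*x+0≈x _

  Λ-var : ∀ F (i : Fin n) → Λ F (var i) ≈ F (unitMon i)
  Λ-var F i = 1*x+0≈x _

  Λ-boolAx : ∀ F (i : Fin n) → Λ F (boolAx i) ≈ F (unitMon i · unitMon i) - F (unitMon i)
  Λ-boolAx F i = a*x+[b*y+0]≈x-y _ _ (*-identityˡ 1#) -1*1≈-1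

  ⋆-one : ∀ F (m : Mon n) → (F ⋆ one) m ≈ F m
  ⋆-one F m = trans (1*x+0≈x _) (reflexive (≡.cong F (·-identityˡ m)))

  ⋆-var : ∀ F (i : Fin n) m → (F ⋆ var i) m ≈ F (unitMon i · m)
  ⋆-var F i m = 1*x+0≈x _

  ⋆-encLit-true : ∀ F (i : Fin n) m → (F ⋆ encLit (i , true)) m ≈ F m - F (unitMon i · m)
  ⋆-encLit-true F i m =
    trans (a*x+[b*y+0]≈x-y _ _ refl -1*1≈-1) (+-congʳ (reflexive (≡.cong F (·-identityˡ m))))

  ⋆-unit⁺ : ∀ F (i : Fin n) m → (F ⋆ encClause (unit⁺ i)) m ≈ F m - F (unitMon i · m)
  ⋆-unit⁺ F i m = trans (⋆-⊗ F (encLit (i , true)) one m)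
    (trans (⋆-one (F ⋆ encLit (i , true)) m) (⋆-encLit-true F i m))

  ⋆-unit⁻ : ∀ F (i : Fin n) m → (F ⋆ encClause (unit⁻ i)) m ≈ F (unitMon i · m)
  ⋆-unit⁻ F i m = trans (⋆-⊗ F (var i) one m) (trans (⋆-one (F ⋆ var i) m) (⋆-var F i m))

  ⋆-implication : ∀ F (a b : Fin n) m →
                  (F ⋆ encClause (implication a b)) m ≈ F (unitMon a · m) - F (unitMon a · (unitMon b · m))
  ⋆-implication F a b m = trans (⋆-⊗ F (var a) (encClause (unit⁺ b)) m)
    (trans (⋆-unit⁺ (F ⋆ var a) b m) (+-cong (⋆-var F a m) (-‿cong (⋆-var F a _))))

  Λ-unit⁺ : ∀ F (i : Fin n) → Λ F (encClause (unit⁺ i)) ≈ F 𝟏 - F (unitMon i)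
  Λ-unit⁺ F i = trans (Λ-⋆-𝟏 F (encClause (unit⁺ i)))
    (trans (⋆-unit⁺ F i 𝟏) (+-congˡ (-‿cong (reflexive (≡.cong F (·-identityʳ _))))))

  Λ-unit⁻ : ∀ F (i : Fin n) → Λ F (encClause (unit⁻ i)) ≈ F (unitMon i)
  Λ-unit⁻ F i = trans (Λ-⋆-𝟏 F (encClause (unit⁻ i)))
    (trans (⋆-unit⁻ F i 𝟏) (reflexive (≡.cong F (·-identityʳ _))))

  Λ-implication : ∀ F (a b : Fin n) →
                  Λ F (encClause (implication a b)) ≈ F (unitMon a) - F (unitMon a · unitMon b)
  Λ-implication F a b = trans (Λ-⋆-𝟏 F (encClause (implication a b))) (trans (⋆-implication F a b 𝟏)
    (+-cong (reflexive (≡.cong F (·-identityʳ _)))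
            (-‿cong (reflexive (≡.cong (λ m → F (unitMon a · m)) (·-identityʳ _))))))

module Coefficients {c ℓ} (𝔽 : Field c ℓ) where
  open import Data.Nat as ℕ using (ℕ; suc; _≤_; z≤n; s≤s)
  import Data.Nat.Properties as ℕ
  open import Data.Nat.Properties using () renaming (_≟_ to _≟ℕ_)
  open import Data.Vec.Properties using (≡-dec)
  open import Data.List using ([]; _∷_; length)
  open import Data.Product using (_,_)
  open import Relation.Nullary using (yes; no; contradiction)
  open import Relation.Binary.PropositionalEquality as ≡ using (_≡_; _≢_)

  open Field 𝔽 hiding (zero)
  open Poly 𝔽
  open Monomials 𝔽
  open Functionals 𝔽
  open import Algebra.Properties.Ring ring using (-1*x≈-x; x∙y⁻¹≈ε⇒x≈y)
  open import Relation.Binary.Reasoning.Setoid setoid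

  private variable n : ℕ

  δ : Mon n → Mon n → Carrier
  δ M m with ≡-dec _≟ℕ_ m M
  ... | yes _ = 1#
  ... | no  _ = 0#

  coeff-Λ : ∀ (p : Pol n) M → coeff p M ≈ Λ (δ M) p
  coeff-Λ []            M = refl
  coeff-Λ ((a , m) ∷ p) M with ≡-dec _≟ℕ_ m M
  ... | yes _ = +-cong (sym (*-identityʳ a)) (coeff-Λ p M)
  ... | no  _ = trans (coeff-Λ p M) (sym (trans (+-congʳ (zeroʳ a)) (+-identityˡ _)))

  ≐-via-δ : ∀ {p q : Pol n} → (∀ M → Λ (δ M) p ≈ Λ (δ M) q) → p ≐ q
  ≐-via-δ {p = p} {q} eq M = trans (coeff-Λ p M) (trans (eq M) (sym (coeff-Λ q M)))

  Λ-δ-injective : ∀ {f : Mon n → Mon n} → (∀ {u v} → f u ≡ f v → u ≡ v) →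
                  ∀ (p : Pol n) M → Λ (λ m → δ (f M) (f m)) p ≈ coeff p M
  Λ-δ-injective {f = f} f-injective p M = trans (Λ-cong p δ-f) (sym (coeff-Λ p M))
    where
    δ-f : ∀ m → δ (f M) (f m) ≈ δ M m
    δ-f m with ≡-dec _≟ℕ_ (f m) (f M) | ≡-dec _≟ℕ_ m M
    ... | yes _  | yes _  = refl
    ... | no  _  | no  _  = refl
    ... | yes fm≡fM | no m≢M = contradiction (f-injective fm≡fM) m≢M
    ... | no fm≢fM  | yes m≡M = contradiction (≡.cong f m≡M) fm≢fM

  without : Mon n → Pol n → Pol n
  without M [] = []
  without M ((a , m) ∷ p) with ≡-dec _≟ℕ_ m M
  ... | yes _ = without M p
  ... | no  _ = (a , m) ∷ without M p

  length-without : ∀ M (p : Pol n) → length (without M p) ≤ length p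
  length-without M []            = z≤n
  length-without M ((a , m) ∷ p) with ≡-dec _≟ℕ_ m M
  ... | yes _ = ℕ.m≤n⇒m≤1+n (length-without M p)
  ... | no  _ = s≤s (length-without M p)

  coeff-without-self : ∀ M (p : Pol n) → coeff (without M p) M ≈ 0#
  coeff-without-self M []            = refl
  coeff-without-self M ((a , m) ∷ p) with ≡-dec _≟ℕ_ m M
  ... | yes _ = coeff-without-self M p
  ... | no m≢M with ≡-dec _≟ℕ_ m M
  ...   | yes m≡M = contradiction m≡M m≢M
  ...   | no  _   = coeff-without-self M p

  coeff-without-other : ∀ M (p : Pol n) {M′} → M′ ≢ M → coeff (without M p) M′ ≈ coeff p M′
  coeff-without-other M []            _    = refl
  coeff-without-other M ((a , m) ∷ p) {M′} M′≢M with ≡-dec _≟ℕ_ m M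
  ... | yes ≡.refl with ≡-dec _≟ℕ_ m M′
  ...   | yes m≡M′ = contradiction (≡.sym m≡M′) M′≢M
  ...   | no  _    = coeff-without-other M p M′≢M
  coeff-without-other M ((a , m) ∷ p) {M′} M′≢M | no _ with ≡-dec _≟ℕ_ m M′
  ...   | yes _ = +-congˡ (coeff-without-other M p M′≢M)
  ...   | no  _ = coeff-without-other M p M′≢M

  Λ-without : ∀ F M (p : Pol n) → Λ F p ≈ coeff p M * F M + Λ F (without M p)
  Λ-without F M []            = sym (trans (+-identityʳ _) (zeroˡ (F M)))
  Λ-without F M ((a , m) ∷ p) with ≡-dec _≟ℕ_ m M
  ... | yes ≡.refl = begin
    a * F m + Λ F p                                    ≈⟨ +-congˡ (Λ-without F m p) ⟩
    a * F m + (coeff p m * F m + Λ F (without m p))    ≈⟨ +-assoc _ _ _ ⟨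
    (a * F m + coeff p m * F m) + Λ F (without m p)    ≈⟨ +-congʳ (distribʳ (F m) a _) ⟨
    (a + coeff p m) * F m + Λ F (without m p)          ∎
  ... | no _ = begin
    a * F m + Λ F p                                    ≈⟨ +-congˡ (Λ-without F M p) ⟩
    a * F m + (coeff p M * F M + Λ F (without M p))    ≈⟨ x∙yz≈y∙xz _ _ _ ⟩
    coeff p M * F M + (a * F m + Λ F (without M p))    ∎
    where open import Algebra.Properties.CommutativeSemigroup +-commutativeSemigroup using (x∙yz≈y∙xz)

  Λ-vanish : ∀ {n} F (p : Pol n) → (∀ M → coeff p M * F M ≈ 0#) → Λ F p ≈ 0#
  Λ-vanish {n} F p = go (length p) p ℕ.≤-refl
    where
    go : ∀ k (p : Pol n) → length p ≤ k → (∀ M → coeff p M * F M ≈ 0#) → Λ F p ≈ 0#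
    go _       []            _            _     = refl
    go (suc k) p@((a , m) ∷ q) (s≤s |q|≤k) vanish = begin
      Λ F p                                  ≈⟨ Λ-without F m p ⟩
      coeff p m * F m + Λ F (without m p)    ≈⟨ +-cong (vanish m) (go k (without m p) |p′|≤k vanish′) ⟩
      0# + 0#                                ≈⟨ +-identityʳ 0# ⟩
      0#                                     ∎
      where
      |p′|≤k : length (without m p) ≤ k
      |p′|≤k with ≡-dec _≟ℕ_ m m
      ... | yes _   = ℕ.≤-trans (length-without m q) |q|≤k
      ... | no m≢m  = contradiction ≡.refl m≢m
      vanish′ : ∀ M → coeff (without m p) M * F M ≈ 0#
      vanish′ M with ≡-dec _≟ℕ_ M m
      ... | yes ≡.refl = trans (*-congʳ (coeff-without-self m p)) (zeroˡ _)
      ... | no M≢m     = trans (*-congʳ (coeff-without-other m p M≢m)) (vanish M)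

  coeff-⊕ : ∀ (p q : Pol n) M → coeff (p ⊕ q) M ≈ coeff p M + coeff q M
  coeff-⊕ p q M = trans (coeff-Λ (p ⊕ q) M)
    (trans (Λ-⊕ (δ M) p q) (sym (+-cong (coeff-Λ p M) (coeff-Λ q M))))

  coeff-scale : ∀ a (p : Pol n) M → coeff (scale a p) M ≈ a * coeff p M
  coeff-scale a p M = trans (coeff-Λ (scale a p) M) (trans (Λ-scale (δ M) a p) (*-congˡ (sym (coeff-Λ p M))))

  Λ-resp-≐ : ∀ F {p q : Pol n} → p ≐ q → Λ F p ≈ Λ F q
  Λ-resp-≐ F {p} {q} p≐q = x∙y⁻¹≈ε⇒x≈y _ _ (begin
    Λ F p - Λ F q                     ≈⟨ +-congˡ (-1*x≈-x _) ⟨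
    Λ F p + - 1# * Λ F q              ≈⟨ +-congˡ (Λ-scale F (- 1#) q) ⟨
    Λ F p + Λ F (scale (- 1#) q)      ≈⟨ Λ-⊕ F p _ ⟨
    Λ F (p ⊕ scale (- 1#) q)          ≈⟨ Λ-vanish F (p ⊕ scale (- 1#) q) vanish ⟩
    0#                                ∎)
    where
    vanish : ∀ M → coeff (p ⊕ scale (- 1#) q) M * F M ≈ 0#
    vanish M = trans (*-congʳ (begin
      coeff (p ⊕ scale (- 1#) q) M      ≈⟨ coeff-⊕ p _ M ⟩
      coeff p M + coeff (scale (- 1#) q) M ≈⟨ +-cong (p≐q M) (trans (coeff-scale (- 1#) q M) (-1*x≈-x _)) ⟩
      coeff q M - coeff q M             ≈⟨ -‿inverseʳ _ ⟩
      0#                                ∎)) (zeroˡ _)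

  ⊗-congˡ : ∀ (r : Pol n) {p q} → p ≐ q → (r ⊗ p) ≐ (r ⊗ q)
  ⊗-congˡ r {p} {q} p≐q = ≐-via-δ {p = r ⊗ p} {r ⊗ q} λ M →
    trans (Λ-⊗ (δ M) r p) (trans (Λ-resp-≐ (δ M ⋆ r) {p} {q} p≐q) (sym (Λ-⊗ (δ M) r q)))

module Degrees {c ℓ} (𝔽 : Field c ℓ) where
  open import Data.Nat as ℕ using (ℕ; zero; suc; _≤_; _<_; z≤n)
  import Data.Nat.Properties as ℕ
  open import Data.Nat.Properties using () renaming (_≟_ to _≟ℕ_)
  open import Data.Fin using (Fin)
  open import Data.Vec using (lookup)
  open import Data.Vec.Properties using (≡-dec; lookup-zipWith)
  open import Data.List as L using ([]; _∷_; length)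
  open import Data.List.Relation.Unary.All as All using (All; []; _∷_)
  open import Data.List.Relation.Unary.All.Properties using (++⁺; map⁺)
  open import Data.Bool using (true; false)
  open import Data.Product using (_×_; _,_; _,′_; proj₁; proj₂)
  open import Relation.Nullary using (yes; no; contradiction)
  open import Relation.Binary.PropositionalEquality as ≡ using (_≡_)

  open Field 𝔽 hiding (zero)
  open Poly 𝔽
  open Monomials 𝔽
  open import Relation.Binary.Reasoning.Setoid setoid

  private variable n : ℕ

  ≐⇒DegLe : ∀ {d} {p q : Pol n} → p ≐ q → DegLe d q → DegLe d p
  ≐⇒DegLe p≐q deg M d<M = trans (p≐q M) (deg M d<M)

  -- A degree bound on the terms as written, ignoring cancellation.
  Deg≤ : ℕ → Pol n → Set c
  Deg≤ d = All (λ t → monDeg (proj₂ t) ≤ d)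

  Deg≤⇒DegLe : ∀ {d} (p : Pol n) → Deg≤ d p → DegLe d p
  Deg≤⇒DegLe []            []            M _   = refl
  Deg≤⇒DegLe ((a , m) ∷ p) (m≤d ∷ p≤d) M d<M with ≡-dec _≟ℕ_ m M
  ... | yes ≡.refl = contradiction m≤d (ℕ.<⇒≱ d<M)
  ... | no  _      = Deg≤⇒DegLe p p≤d M d<M

  Deg≤-mono : ∀ {d e} {p : Pol n} → d ≤ e → Deg≤ d p → Deg≤ e p
  Deg≤-mono d≤e = All.map (λ m≤d → ℕ.≤-trans m≤d d≤e)

  Deg≤-⊗ : ∀ {n d e} {p q : Pol n} → Deg≤ d p → Deg≤ e q → Deg≤ (d ℕ.+ e) (p ⊗ q)
  Deg≤-⊗ []                              _   = []
  Deg≤-⊗ {n} {d} {e} {(a , u) ∷ p} {q} (u≤d ∷ p≤d) q≤e = ++⁺ row (Deg≤-⊗ p≤d q≤e)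
    where
    term≤ : ∀ {t : Carrier × Mon n} → monDeg (proj₂ t) ≤ e → monDeg (u · proj₂ t) ≤ d ℕ.+ e
    term≤ {_ , m} m≤e = ℕ.≤-trans (ℕ.≤-reflexive (monDeg-· u m)) (ℕ.+-mono-≤ u≤d m≤e)
    row : Deg≤ (d ℕ.+ e) (L.map (λ (t : Carrier × Mon n) → a * proj₁ t ,′ u · proj₂ t) q)
    row = map⁺ (All.map (λ {t} → term≤ {t}) q≤e)

  Deg≤-one : Deg≤ 0 (one {n})
  Deg≤-one {n} = ℕ.≤-reflexive (monDeg-𝟏 {n}) ∷ []

  Deg≤-var : ∀ (i : Fin n) → Deg≤ 1 (var i)
  Deg≤-var i = ℕ.≤-reflexive (monDeg-unitMon i) ∷ []

  Deg≤-encLit : ∀ (l : Literal n) → Deg≤ 1 (encLit l)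
  Deg≤-encLit {n} (i , true)  =
    ℕ.≤-trans (ℕ.≤-reflexive (monDeg-𝟏 {n})) z≤n ∷ ℕ.≤-reflexive (monDeg-unitMon i) ∷ []
  Deg≤-encLit     (i , false) = Deg≤-var i

  Deg≤-encClause : ∀ (C : Clause n) → Deg≤ (length C) (encClause C)
  Deg≤-encClause []      = Deg≤-one
  Deg≤-encClause (l ∷ C) = Deg≤-⊗ (Deg≤-encLit l) (Deg≤-encClause C)

  exponentBound : Fin n → Pol n → ℕ
  exponentBound i []            = 0
  exponentBound i ((a , m) ∷ p) = suc (lookup m i) ℕ.+ exponentBound i p

  coeff-beyond-exponentBound : ∀ i (p : Pol n) M → exponentBound i p ≤ lookup M i → coeff p M ≈ 0#
  coeff-beyond-exponentBound i []            M _     = refl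
  coeff-beyond-exponentBound i ((a , m) ∷ p) M bound with ≡-dec _≟ℕ_ m M
  ... | yes ≡.refl = contradiction (ℕ.m+n≤o⇒m≤o (suc (lookup m i)) bound) (ℕ.n≮n _)
  ... | no  _      = coeff-beyond-exponentBound i p M (ℕ.m+n≤o⇒n≤o (suc (lookup m i)) bound)

  shiftBy : Fin n → ℕ → Mon n → Mon n
  shiftBy i zero    X = X
  shiftBy i (suc t) X = unitMon i · shiftBy i t X

  lookup-shiftBy : ∀ (i : Fin n) t X → lookup (shiftBy i t X) i ≡ t ℕ.+ lookup X i
  lookup-shiftBy i zero    X = ≡.refl
  lookup-shiftBy i (suc t) X = ≡.trans (lookup-zipWith ℕ._+_ i (unitMon i) (shiftBy i t X))
                                       (≡.cong₂ ℕ._+_ (lookup-unitMon i) (lookup-shiftBy i t X))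

  monDeg-shiftBy : ∀ (i : Fin n) t X → monDeg (shiftBy i t X) ≡ t ℕ.+ monDeg X
  monDeg-shiftBy i zero    X = ≡.refl
  monDeg-shiftBy i (suc t) X =
    ≡.trans (monDeg-unitMon-· i (shiftBy i t X)) (≡.cong suc (monDeg-shiftBy i t X))

  -- Shifting far enough by x_i leaves the finite support of g.
  shift-invariant⇒coeff≈0 : ∀ (g : Pol n) i k d →
    (∀ Y → d < k ℕ.+ monDeg Y → coeff g (unitMon i · Y) ≈ coeff g Y) →
    ∀ X → d < k ℕ.+ monDeg X → coeff g X ≈ 0#
  shift-invariant⇒coeff≈0 g i k d invariant X d<k+X = begin
    coeff g X                     ≈⟨ shifted t ⟨
    coeff g (shiftBy i t X)       ≈⟨ coeff-beyond-exponentBound i g _ beyond ⟩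
    0#                            ∎
    where
    t = exponentBound i g
    shifted : ∀ s → coeff g (shiftBy i s X) ≈ coeff g X
    shifted zero    = refl
    shifted (suc s) = trans (invariant (shiftBy i s X) (ℕ.<-≤-trans d<k+X (ℕ.+-monoʳ-≤ k
                        (ℕ.≤-trans (ℕ.m≤n+m (monDeg X) s) (ℕ.≤-reflexive (≡.sym (monDeg-shiftBy i s X)))))))
                            (shifted s)
    beyond : t ≤ lookup (shiftBy i t X) i
    beyond = ℕ.≤-trans (ℕ.m≤m+n t (lookup X i)) (ℕ.≤-reflexive (≡.sym (lookup-shiftBy i t X)))

module NullstellensatzDuality {c ℓ} (𝔽 : Field c ℓ) where
  open import Level using (_⊔_)
  open import Data.Nat as ℕ using (ℕ; zero; suc; _≤_; _<_; _≤?_)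
  import Data.Nat.Properties as ℕ
  open import Data.Fin using (Fin; zero; suc)
  open import Data.List as L using (List; length)
  open import Data.List.Membership.Propositional.Properties using (∈-lookup)
  open import Data.List.Relation.Unary.All as All using (All)
  open import Data.Product using (_,_)
  open import Function.Base using (_∘′_)
  open import Relation.Nullary using (¬_; yes; no)
  open import Relation.Binary.PropositionalEquality as ≡ using (_≡_)

  open Field 𝔽 hiding (zero)
  open Poly 𝔽
  open Monomials 𝔽
  open Functionals 𝔽
  open Coefficients 𝔽
  open Degrees 𝔽
  open InductionFormula
  open import Algebra.Properties.Ring ring using (x∙y⁻¹≈ε⇒x≈y; x≈y⇒x∙y⁻¹≈ε)
  open import Relation.Binary.Reasoning.Setoid setoid

  private variable n : ℕ

  Annihilates : ℕ → (Mon n → Carrier) → Pol n → Set (c ⊔ ℓ)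
  Annihilates d F p = ∀ g → DegLe d (p ⊗ g) → Λ F (p ⊗ g) ≈ 0#

  Multilinear : (Mon n → Carrier) → Set ℓ
  Multilinear {n} F = ∀ u (i : Fin n) → F (u · (unitMon i · unitMon i)) ≈ F (u · unitMon i)

  Λ-ΣF : ∀ F k (f : Fin k → Pol n) → (∀ j → Λ F (f j) ≈ 0#) → Λ F (ΣF k f) ≈ 0#
  Λ-ΣF F zero    f _     = refl
  Λ-ΣF F (suc k) f f≈0 = begin
    Λ F (f zero ⊕ ΣF k (f ∘′ suc))          ≈⟨ Λ-⊕ F (f zero) _ ⟩
    Λ F (f zero) + Λ F (ΣF k (f ∘′ suc))    ≈⟨ +-cong (f≈0 zero) (Λ-ΣF F k (f ∘′ suc) (λ j → f≈0 (suc j))) ⟩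
    0# + 0#                                 ≈⟨ +-identityʳ 0# ⟩
    0#                                      ∎

  Multilinear⇒annihilates-boolAx : ∀ {F : Mon n → Carrier} → Multilinear F → ∀ i h → Λ F (h ⊗ boolAx i) ≈ 0#
  Multilinear⇒annihilates-boolAx {F = F} multilinear i h = begin
    Λ F (h ⊗ boolAx i)                                    ≈⟨ Λ-⊗ F h (boolAx i) ⟩
    Λ (F ⋆ h) (boolAx i)                                  ≈⟨ Λ-boolAx (F ⋆ h) i ⟩
    (F ⋆ h) (unitMon i · unitMon i) - (F ⋆ h) (unitMon i) ≈⟨ x≈y⇒x∙y⁻¹≈ε (Λ-cong h λ u → multilinear u i) ⟩
    0#                                                    ∎

  no-NSRefutation : ∀ {d} {P : List (Pol n)} (F : Mon n → Carrier) → F 𝟏 ≈ 1# → Multilinear F →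
                    All (Annihilates d F) P → (r : NSRefutation P) → ¬ NSDegLe d r
  no-NSRefutation {n} {d} {P} F F𝟏≈1 multilinear annihilates r (axioms-deg , _) = 0≉1 (begin
    0#                                     ≈⟨ +-identityʳ 0# ⟨
    0# + 0#                                ≈⟨ +-cong axioms≈0 boolean≈0 ⟨
    Λ F axiom-part + Λ F boolean-part      ≈⟨ Λ-⊕ F axiom-part boolean-part ⟨
    Λ F (axiom-part ⊕ boolean-part)        ≈⟨ Λ-resp-≐ F {axiom-part ⊕ boolean-part} {one} eq ⟩
    Λ F one                                ≈⟨ Λ-one F ⟩
    F 𝟏                                    ≈⟨ F𝟏≈1 ⟩
    1#                                     ∎)
    where
    open NSRefutation r
    axiom-part boolean-part : Pol n
    axiom-part   = ΣF (length P) (λ j → L.lookup P j ⊗ g j)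
    boolean-part = ΣF n (λ i → h i ⊗ boolAx i)
    axioms≈0 : Λ F axiom-part ≈ 0#
    axioms≈0 = Λ-ΣF F _ _ λ j → All.lookup annihilates (∈-lookup j) (g j) (axioms-deg j)
    boolean≈0 : Λ F boolean-part ≈ 0#
    boolean≈0 = Λ-ΣF F _ _ λ i → Multilinear⇒annihilates-boolAx multilinear i (h i)

  annihilates-unit⁺ : ∀ {d} {F : Mon n → Carrier} i → (∀ m → F (unitMon i · m) ≈ F m) →
                      Annihilates d F (encClause (unit⁺ i))
  annihilates-unit⁺ {F = F} i F-ignores g _ = trans (Λ-⊗ F (encClause (unit⁺ i)) g)
    (Λ-zero g λ m → trans (⋆-unit⁺ F i m) (x≈y⇒x∙y⁻¹≈ε (sym (F-ignores m))))

  annihilates-unit⁻ : ∀ {d} {F : Mon n → Carrier} i → (∀ m → F (unitMon i · m) ≈ 0#) →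
                      Annihilates d F (encClause (unit⁻ i))
  annihilates-unit⁻ {F = F} i F-vanishes g _ = trans (Λ-⊗ F (encClause (unit⁻ i)) g)
    (Λ-zero g λ m → trans (⋆-unit⁻ F i m) (F-vanishes m))

  coeff-⊗-implication : ∀ (a b : Fin n) g Y →
    coeff (encClause (implication a b) ⊗ g) (unitMon a · (unitMon b · Y)) ≈ coeff g (unitMon b · Y) - coeff g Y
  coeff-⊗-implication a b g Y = begin
    coeff (p ⊗ g) M                                     ≈⟨ coeff-Λ (p ⊗ g) M ⟩
    Λ (δ M) (p ⊗ g)                                     ≈⟨ Λ-⊗ (δ M) p g ⟩
    Λ (δ M ⋆ p) g                                       ≈⟨ Λ-cong g (⋆-implication (δ M) a b) ⟩
    Λ (λ m → δ M (xa · m) - δ M (xa · (xb · m))) g      ≈⟨ Λ-- _ _ g ⟩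
    Λ (λ m → δ M (xa · m)) g - Λ (λ m → δ M (xa · (xb · m))) g
      ≈⟨ +-cong (Λ-δ-injective (·-cancelˡ xa) g _)
                (-‿cong (Λ-δ-injective (·-cancelˡ xb ∘′ ·-cancelˡ xa) g Y)) ⟩
    coeff g (xb · Y) - coeff g Y                        ∎
    where
    p = encClause (implication a b)
    xa = unitMon a
    xb = unitMon b
    M = xa · (xb · Y)

  annihilates-implication : ∀ {d} {F : Mon n → Carrier} a b →
    (∀ m → 2 ℕ.+ monDeg m ≤ d → F (unitMon a · m) ≈ F (unitMon a · (unitMon b · m))) →
    Annihilates d F (encClause (implication a b))
  annihilates-implication {d = d} {F} a b F-step g deg = trans (Λ-⊗ F p g) (Λ-vanish (F ⋆ p) g vanish)
    where
    p = encClause (implication a b)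
    monDeg-xa·xb·Y : ∀ Y → monDeg (unitMon a · (unitMon b · Y)) ≡ 2 ℕ.+ monDeg Y
    monDeg-xa·xb·Y Y = ≡.trans (monDeg-unitMon-· a _) (≡.cong suc (monDeg-unitMon-· b Y))
    -- The degree bound forces the coefficients of g in high degree to be
    -- invariant under multiplication by x_b.
    high : ∀ X → d < 2 ℕ.+ monDeg X → coeff g X ≈ 0#
    high = shift-invariant⇒coeff≈0 g b 2 d λ Y d<2+Y → x∙y⁻¹≈ε⇒x≈y _ _
      (trans (sym (coeff-⊗-implication a b g Y)) (deg _ (≡.subst (d <_) (≡.sym (monDeg-xa·xb·Y Y)) d<2+Y)))
    vanish : ∀ M → coeff g M * (F ⋆ p) M ≈ 0#
    vanish M with 2 ℕ.+ monDeg M ≤? d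
    ... | yes small = trans (*-congˡ (trans (⋆-implication F a b M) (x≈y⇒x∙y⁻¹≈ε (F-step M small)))) (zeroʳ _)
    ... | no  large = trans (*-congʳ (high M (ℕ.≰⇒> large))) (zeroˡ _)

module PebblingFunctional {c ℓ} (𝔽 : Field c ℓ) where
  open import Data.Bool using (true; false)
  open import Data.Bool.Properties using (not-¬)
  open import Data.Nat as ℕ using (ℕ; zero; suc; _^_; _≤_; _<_; s≤s; z≤n)
  import Data.Nat.Properties as ℕ
  open import Data.Fin using (Fin; zero; suc; toℕ; inject₁; fromℕ)
  open import Data.Fin.Properties using (toℕ-inject₁; toℕ-fromℕ; toℕ<n)
  open import Data.Vec using (Vec; []; _∷_)
  open import Data.List using ([]; _∷_; length)
  open import Data.List.Relation.Unary.All.Properties using (map⁺)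
  open import Function.Base using (_∘_)
  open import Function.Bundles using (_⇔_; Equivalence)
  open import Relation.Nullary using (¬_; yes; no; contradiction)
  open import Relation.Binary.PropositionalEquality

  open Field 𝔽 using (Carrier; 0#; 1#; reflexive)
  open Poly 𝔽
  open Monomials 𝔽
  open NullstellensatzDuality 𝔽
  open InductionFormula
  open Pebbling

  private variable n : ℕ

  support : Vec ℕ n → Config
  support []          = []
  support (zero  ∷ v) = false ∷ support v
  support (suc _ ∷ v) = true ∷ support v

  -- The axiom x₀ makes x₀ irrelevant: position j of the configuration is x_{j+1}.
  config : Mon (suc n) → Config
  config (_ ∷ v) = support v

  length-config : ∀ (m : Mon (suc n)) → length (config m) ≡ n
  length-config (_ ∷ v) = length-support v
    where
    length-support : ∀ {n} (v : Vec ℕ n) → length (support v) ≡ n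
    length-support []          = refl
    length-support (zero  ∷ v) = cong suc (length-support v)
    length-support (suc _ ∷ v) = cong suc (length-support v)

  pebbles-config : ∀ (m : Mon (suc n)) → pebbles (config m) ≤ monDeg m
  pebbles-config (x ∷ v) = ℕ.≤-trans (pebbles-support v) (ℕ.m≤n+m _ x)
    where
    pebbles-support : ∀ {n} (v : Vec ℕ n) → pebbles (support v) ≤ monDeg v
    pebbles-support []          = z≤n
    pebbles-support (zero  ∷ v) = pebbles-support v
    pebbles-support (suc x ∷ v) = s≤s (ℕ.≤-trans (pebbles-support v) (ℕ.m≤n+m _ x))

  pebbles-config-𝟏 : pebbles (config (𝟏 {suc n})) ≡ 0
  pebbles-config-𝟏 {zero}  = refl
  pebbles-config-𝟏 {suc n} = pebbles-config-𝟏 {n}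

  config-unitMon-zero : ∀ (m : Mon (suc n)) → config (unitMon zero · m) ≡ config m
  config-unitMon-zero (_ ∷ v) = cong support (·-identityˡ v)

  config-unitMon-suc : ∀ (j : Fin n) m → config (unitMon (suc j) · m) ≡ place (toℕ j) (config m)
  config-unitMon-suc j (_ ∷ v) = support-unitMon-· j v
    where
    support-unitMon-· : ∀ {n} (j : Fin n) v → support (unitMon j · v) ≡ place (toℕ j) (support v)
    support-unitMon-· zero    (zero  ∷ v) = cong (true ∷_) (cong support (·-identityˡ v))
    support-unitMon-· zero    (suc _ ∷ v) = cong (true ∷_) (cong support (·-identityˡ v))
    support-unitMon-· (suc j) (zero  ∷ v) = cong (false ∷_) (support-unitMon-· j v)
    support-unitMon-· (suc j) (suc _ ∷ v) = cong (true ∷_) (support-unitMon-· j v)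

  config-unitMon-suc-pebbled : ∀ (j : Fin n) m → config (unitMon (suc j) · m) at toℕ j ≡ true
  config-unitMon-suc-pebbled j m = trans (cong (_at toℕ j) (config-unitMon-suc j m))
    (at-place (toℕ j) (config m) (subst (toℕ j <_) (sym (length-config m)) (toℕ<n j)))

  config-square : ∀ (u w : Mon (suc n)) → config (u · (w · w)) ≡ config (u · w)
  config-square (_ ∷ u) (_ ∷ w) = support-square u w
    where
    support-square : ∀ {n} (u w : Vec ℕ n) → support (u · (w · w)) ≡ support (u · w)
    support-square []          []          = refl
    support-square (suc _ ∷ u) (_     ∷ w) = cong (true ∷_) (support-square u w)
    support-square (zero  ∷ u) (zero  ∷ w) = cong (false ∷_) (support-square u w)
    support-square (zero  ∷ u) (suc _ ∷ w) = cong (true ∷_) (support-square u w)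

  goodness : ℕ → Config → Carrier
  goodness d C with good? d C
  ... | yes _ = 1#
  ... | no  _ = 0#

  goodness-good : ∀ {d C} → Good d C → goodness d C ≡ 1#
  goodness-good {d} {C} good with good? d C
  ... | yes _   = refl
  ... | no  bad = contradiction good bad

  goodness-bad : ∀ {d C} → ¬ Good d C → goodness d C ≡ 0#
  goodness-bad {d} {C} bad with good? d C
  ... | yes good = contradiction good bad
  ... | no  _    = refl

  goodness-⇔ : ∀ {d C C′} → Good d C ⇔ Good d C′ → goodness d C ≡ goodness d C′
  goodness-⇔ {d} {C} {C′} C⇔C′ with good? d C | good? d C′
  ... | yes _    | yes _    = refl
  ... | no  _    | no  _    = refl
  ... | yes good | no  bad  = contradiction (Equivalence.to C⇔C′ good) bad
  ... | no  bad  | yes good = contradiction (Equivalence.from C⇔C′ good) bad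

  pebbling : ℕ → Mon (suc n) → Carrier
  pebbling d m = goodness d (config m)

  pebbling-𝟏 : ∀ {N d} → pebbling d (𝟏 {suc N}) ≡ 1#
  pebbling-𝟏 {N} {d} = goodness-good (Good-empty d _ (pebbles-config-𝟏 {N}))

  pebbling-multilinear : ∀ {N d} → Multilinear (pebbling {N} d)
  pebbling-multilinear {d = d} u i = reflexive (cong (goodness d) (config-square u (unitMon i)))

  pebbling-x₀ : ∀ {N d} m → pebbling {N} d (unitMon zero · m) ≡ pebbling d m
  pebbling-x₀ {d = d} m = cong (goodness d) (config-unitMon-zero m)

  pebbling-x_N : ∀ {N d} → 2 ^ d ≤ N → ∀ m → pebbling {N} d (unitMon (fromℕ N) · m) ≡ 0#
  pebbling-x_N {zero}   {d} 2^d≤0    m = contradiction 2^d≤0 (ℕ.<⇒≱ (ℕ.m^n>0 2 d))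
  pebbling-x_N {suc N′} {d} 2^d≤1+N′ m = goodness-bad λ good →
    contradiction (Good-sound d _ N′ good 2^d≤1+N′) (not-¬ pebbled)
    where
    pebbled : config (unitMon (fromℕ (suc N′)) · m) at N′ ≡ true
    pebbled = subst (λ k → config (unitMon (fromℕ (suc N′)) · m) at k ≡ true) (toℕ-fromℕ N′)
                    (config-unitMon-suc-pebbled (fromℕ N′) m)

  -- Between x_j m and x_j x_{j+1} m the pebble on x_{j+1} is placed
  -- legally, since x_j is pebbled (or j = 0).
  pebbling-step : ∀ {N d} (j : Fin N) m → 2 ℕ.+ monDeg m ≤ d →
                  pebbling d (unitMon (inject₁ j) · m) ≡ pebbling d (unitMon (inject₁ j) · (unitMon (suc j) · m))
  pebbling-step {N} {d} j m 2+m≤d = begin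
    goodness d C                        ≡⟨ goodness-⇔ (Good-place d (legal j) C≤d C′≤d) ⟩
    goodness d (place (toℕ j) C)        ≡⟨ cong (goodness d) C′≡ ⟨
    goodness d (config (xa · (xb · m))) ∎
    where
    open ≡-Reasoning
    xa = unitMon (inject₁ j)
    xb = unitMon (suc j)
    C = config (xa · m)
    C′≡ : config (xa · (xb · m)) ≡ place (toℕ j) C
    C′≡ = trans (cong config (u·[v·w]≡v·[u·w] xa xb m)) (config-unitMon-suc j (xa · m))
    C≤d : pebbles C ≤ d
    C≤d = ℕ.≤-trans (pebbles-config (xa · m))
            (ℕ.≤-trans (ℕ.≤-reflexive (monDeg-unitMon-· (inject₁ j) m)) (ℕ.m+n≤o⇒n≤o 1 2+m≤d))
    C′≤d : pebbles (place (toℕ j) C) ≤ d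
    C′≤d = subst (λ C′ → pebbles C′ ≤ d) C′≡ (ℕ.≤-trans (pebbles-config (xa · (xb · m)))
             (ℕ.≤-trans (ℕ.≤-reflexive (trans (monDeg-unitMon-· (inject₁ j) _)
                                              (cong suc (monDeg-unitMon-· (suc j) m)))) 2+m≤d))
    legal : ∀ (j : Fin N) → Legal (config (unitMon (inject₁ j) · m)) (toℕ j)
    legal zero     = legal-first
    legal (suc j′) = legal-next (subst (λ k → config (unitMon (inject₁ (suc j′)) · m) at k ≡ true)
                                       (toℕ-inject₁ j′) (config-unitMon-suc-pebbled (inject₁ j′) m))

  inductionCNF-NS-degree : ∀ N d → 2 ^ d ≤ N →
                           (r : NSRefutation (encCNF (inductionCNF N))) → ¬ NSDegLe d r
  inductionCNF-NS-degree N d 2^d≤N =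
    no-NSRefutation (pebbling d) (reflexive (pebbling-𝟏 {d = d})) (pebbling-multilinear {d = d})
      (map⁺ (All-inductionCNF
        (annihilates-unit⁺ zero (reflexive ∘ pebbling-x₀ {d = d}))
        (λ j → annihilates-implication (inject₁ j) (suc j) λ m → reflexive ∘ pebbling-step j m)
        (annihilates-unit⁻ (fromℕ N) (reflexive ∘ pebbling-x_N {d = d} 2^d≤N))))

module MonomialCalculusUpperBound {c ℓ} (𝔽 : Field c ℓ) where
  open import Level using (_⊔_)
  open import Data.Nat using (ℕ; _≤_; z≤n; s≤s)
  open import Data.Nat.Properties using (≤-refl)
  open import Data.Fin using (zero; suc; inject₁; fromℕ)
  open import Data.Fin.Induction using (>-weakInduction)
  open import Data.List using (List; length)
  open import Data.List.Membership.Propositional using (_∈_)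
  open import Data.List.Membership.Propositional.Properties using (∈-map⁺)
  open import Data.Product using (Σ; _×_; _,_)
  open import Data.Sum using (inj₁)

  open Field 𝔽 hiding (zero)
  open Poly 𝔽
  open Monomials 𝔽
  open Functionals 𝔽
  open Coefficients 𝔽
  open Degrees 𝔽
  open InductionFormula
  open import Algebra.Properties.Ring ring using (//-rightDividesˡ)
  open import Relation.Binary.Reasoning.Setoid setoid

  private variable n : ℕ

  Derives : List (Pol n) → ℕ → Pol n → Set (c ⊔ ℓ)
  Derives {n} P d q = Σ (Pol n) λ p → MCDeriv P d p × p ≐ q

  DegLe-encClause : ∀ {d} (C : Clause n) → length C ≤ d → DegLe d (encClause C)
  DegLe-encClause C |C|≤d = Deg≤⇒DegLe _ (Deg≤-mono |C|≤d (Deg≤-encClause C))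

  1*[y-x]+1*x≈y : ∀ x y → 1# * (y - x) + 1# * x ≈ y
  1*[y-x]+1*x≈y x y = trans (+-cong (*-identityˡ _) (*-identityˡ x)) (//-rightDividesˡ x y)

  derive-unit⁻ : ∀ {P : List (Pol n)} i → encClause (unit⁻ i) ∈ P → Derives P 2 (var i)
  derive-unit⁻ i ∈P = encClause (unit⁻ i) , axP ∈P (DegLe-encClause (unit⁻ i) (s≤s z≤n)) ,
    ≐-via-δ {p = encClause (unit⁻ i)} {var i} λ M → trans (Λ-unit⁻ (δ M) i) (sym (Λ-var (δ M) i))

  -- x_a · x_b is a legal multiplication of the monomial x_b, and adding the
  -- axiom x_a (1 - x_b) leaves x_a.
  derive-implication : ∀ {P : List (Pol n)} a b → encClause (implication a b) ∈ P →
                       Derives P 2 (var b) → Derives P 2 (var a)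
  derive-implication {n} {P} a b ∈P (p , p-deriv , p≐xb) =
    r , lin 1# 1# q-deriv (axP ∈P (DegLe-encClause (implication a b) ≤-refl)) r-deg , r≐xa
    where
    ab = unitMon a · unitMon b
    q r : Pol n
    q = var a ⊗ p
    r = scale 1# q ⊕ scale 1# (encClause (implication a b))
    q≐xaxb : q ≐ (var a ⊗ var b)
    q≐xaxb = ⊗-congˡ (var a) {p} {var b} p≐xb
    q-deriv : MCDeriv P 2 q
    q-deriv = mul a p-deriv (inj₁ (1# , unitMon b , p≐xb))
      (≐⇒DegLe {p = q} {var a ⊗ var b} q≐xaxb (Deg≤⇒DegLe _ (Deg≤-⊗ (Deg≤-var a) (Deg≤-var b))))
    r≐xa : r ≐ var a
    r≐xa = ≐-via-δ {p = r} {var a} λ M → begin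
      Λ (δ M) r                                                          ≈⟨ Λ-lin (δ M) 1# 1# q _ ⟩
      1# * Λ (δ M) q + 1# * Λ (δ M) (encClause (implication a b))
        ≈⟨ +-cong (*-congˡ (Λ-resp-≐ (δ M) {q} {var a ⊗ var b} q≐xaxb))
                  (*-congˡ (Λ-implication (δ M) a b)) ⟩
      1# * Λ (δ M) (var a ⊗ var b) + 1# * (δ M (unitMon a) - δ M ab)
        ≈⟨ +-congʳ (*-congˡ (trans (Λ-⊗ (δ M) (var a) (var b))
                                   (trans (Λ-var (δ M ⋆ var a) b) (⋆-var (δ M) a _)))) ⟩
      1# * δ M ab + 1# * (δ M (unitMon a) - δ M ab)                      ≈⟨ +-comm _ _ ⟩
      1# * (δ M (unitMon a) - δ M ab) + 1# * δ M ab                      ≈⟨ 1*[y-x]+1*x≈y _ _ ⟩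
      δ M (unitMon a)                                                    ≈⟨ Λ-var (δ M) a ⟨
      Λ (δ M) (var a)                                                    ∎
    r-deg : DegLe 2 r
    r-deg = ≐⇒DegLe {p = r} {var a} r≐xa (Deg≤⇒DegLe _ (Deg≤-mono (s≤s z≤n) (Deg≤-var a)))

  refute-unit⁺ : ∀ {P : List (Pol n)} a → encClause (unit⁺ a) ∈ P → Derives P 2 (var a) → MCRefutes 2 P
  refute-unit⁺ {n} {P} a ∈P (p , p-deriv , p≐xa) =
    s , lin 1# 1# (axP ∈P (DegLe-encClause (unit⁺ a) (s≤s z≤n))) p-deriv s-deg , s≐1
    where
    s : Pol n
    s = scale 1# (encClause (unit⁺ a)) ⊕ scale 1# p
    s≐1 : s ≐ one
    s≐1 = ≐-via-δ {p = s} {one} λ M → begin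
      Λ (δ M) s                                                 ≈⟨ Λ-lin (δ M) 1# 1# (encClause (unit⁺ a)) p ⟩
      1# * Λ (δ M) (encClause (unit⁺ a)) + 1# * Λ (δ M) p
        ≈⟨ +-cong (*-congˡ (Λ-unit⁺ (δ M) a))
                  (*-congˡ (trans (Λ-resp-≐ (δ M) {p} {var a} p≐xa) (Λ-var (δ M) a))) ⟩
      1# * (δ M 𝟏 - δ M (unitMon a)) + 1# * δ M (unitMon a)     ≈⟨ 1*[y-x]+1*x≈y _ _ ⟩
      δ M 𝟏                                                     ≈⟨ Λ-one (δ M) ⟨
      Λ (δ M) one                                               ∎
    s-deg : DegLe 2 s
    s-deg = ≐⇒DegLe {p = s} {one} s≐1 (Deg≤⇒DegLe _ (Deg≤-mono z≤n Deg≤-one))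

  inductionCNF-MC : ∀ N → MCRefutes 2 (encCNF (inductionCNF N))
  inductionCNF-MC N = refute-unit⁺ zero (∈-map⁺ encClause unit⁺∈inductionCNF) (x-derivable zero)
    where
    x-derivable : ∀ i → Derives (encCNF (inductionCNF N)) 2 (var i)
    x-derivable = >-weakInduction _ (derive-unit⁻ (fromℕ N) (∈-map⁺ encClause unit⁻∈inductionCNF))
      (λ j → derive-implication (inject₁ j) (suc j) (∈-map⁺ encClause (step∈inductionCNF j)))

open import Data.Nat using (suc; _+_; _^_; _<_; s≤s)
open import Data.Nat.Properties using (≤-trans; ≤-reflexive; ≮⇒≥; <⇒≤; n≤1+n; m≤m+n; m≤n+m; m≤n*m)
open import Data.Nat.Logarithm using (⌈log₂⌉-mono-≤; ⌈log₂2^n⌉≡n)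
open import Data.Product using (_,_)
open import Relation.Nullary using (¬_)
open InductionFormula using (inductionCNF; inductionCNF-unsatisfiable)
open MonomialCalculusUpperBound using (inductionCNF-MC)
open PebblingFunctional using (inductionCNF-NS-degree)

⌈log₂⌉≤ : ∀ n d → ¬ (2 ^ d < n) → ⌈log₂ n ⌉ ≤ d
⌈log₂⌉≤ n d 2^d≮n = ≤-trans (⌈log₂⌉-mono-≤ (≮⇒≥ 2^d≮n)) (≤-reflexive (⌈log₂2^n⌉≡n d))

suc-isΘn : IsΘn suc
suc-isΘn = 1 , 2 , 1 , λ { (suc n) _ →
  ≤-trans (n≤1+n (suc n)) (m≤n*m (suc (suc n)) 1) ,
  s≤s (≤-trans (m≤m+n (suc n) 0) (m≤n+m (suc n + 0) n)) }

theorem3p9 : ∀ {c ℓ} (𝔽 : Field c ℓ) → let open Poly 𝔽 in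
    Σ (ℕ → Σ ℕ CNF) λ F →
      IsΘn (λ n → proj₁ (F n)) ×
      (∀ n → Unsatisfiable (proj₂ (F n))) ×
      (∀ n → MCRefutes 2 (encCNF (proj₂ (F n)))) ×
      (∀ n (r : NSRefutation (encCNF (proj₂ (F n)))) (d : ℕ) →
         NSDegLe d r → ⌈log₂ n ⌉ ≤ d)
theorem3p9 𝔽 =
  (λ n → suc n , inductionCNF n) ,
  suc-isΘn ,
  inductionCNF-unsatisfiable ,
  inductionCNF-MC 𝔽 ,
  λ n r d r-deg → ⌈log₂⌉≤ n d λ 2^d<n → inductionCNF-NS-degree 𝔽 n d (<⇒≤ 2^d<n) r r-deg
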